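{- Let $(H,\eta)$ be an extended strip decomposition of a graph $G$ and let $x,y\in V(G)$ be two distinct vertices that are peripheral in $(H,\eta)$. Let $Q=(x=x_0,x_1,\dots,x_k=y)$ be an induced path in $G$ with endpoints $x$ and $y$. Then for every edge $ab\in E(H)$ we have $|V(Q)\cap\eta(ab,a)|\le 1$, and $V(Q)\subseteq\bigcup_{e\in E(H)}\eta(e)$.
   Context: All graphs are finite and simple. $T(H)$ denotes the set of triangles of $H$. An extended strip decomposition of $G$ is a pair $(H,\eta)$ where $H$ is a simple graph, $\eta(x)\subseteq V(G)$ for each $x\in V(H)$, $\eta(xy)\subseteq V(G)$ for each $xy\in E(H)$ together with subsets $\eta(xy,x),\eta(xy,y)\subseteq\eta(xy)$ (interfaces), and $\eta(xyz)\subseteq V(G)$ for each $xyz\in T(H)$, such that: (1) the sets $\eta(o)$, $o\in V(H)\cup E(H)\cup T(H)$, partition $V(G)$; (2) for every $x\in V(H)$ and distinct $y,z\in N_H(x)$, $\eta(xy,x)$ is complete to $\eta(xz,x)$; (3) every edge $uv\in E(G)$ either has both ends in one set $\eta(o)$, or $u\in\eta(xy,x)$, $v\in\eta(xz,x)$ for some $x\in V(H)$ and $y,z\in N_H(x)$, or $u\in\eta(xy,x)$, $v\in\eta(x)$ for some $xy\in E(H)$, or $u\in\eta(xyz)$ and $v\in\eta(xy,x)\cap\eta(xy,y)$ for some $xyz\in T(H)$. A vertex $v\in V(G)$ is peripheral in $(H,\eta)$ if there is a vertex $x$ of degree one in $H$ with unique neighbor $y$ such that $\eta(xy,x)=\{v\}$.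 -}

module Defs where

open import Data.Nat using (ℕ; suc)
open import Data.Fin using (Fin; toℕ; zero; fromℕ)
open import Data.Product using (Σ; ∃; ∃-syntax; _×_)
open import Data.Sum using (_⊎_)
open import Data.Unit using (⊤)
open import Relation.Nullary using (¬_)
open import Relation.Binary.PropositionalEquality using (_≡_; _≢_)
open import Function.Bundles using (_⇔_)
open import Function.Definitions using (Injective)

record Graph (n : ℕ) : Set₁ where
  field
    Adj     : Fin n → Fin n → Set
    sym     : ∀ {u v} → Adj u v → Adj v u
    irrefl  : ∀ {u} → ¬ Adj u u
open Graph public

IsTriangle : ∀ {m} → Graph m → Fin m → Fin m → Fin m → Set
IsTriangle H x y z = Adj H x y × Adj H y z × Adj H x z

-- The "location" of a vertex of G: the unique o ∈ V(H) ∪ E(H) ∪ T(H) with v ∈ η(o).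
-- Edges / triangles are written by an ordered representative; η(xy) and η(xyz)
-- below are defined invariantly under reordering.
data Loc (m : ℕ) : Set where
  vtx : Fin m → Loc m
  edg : Fin m → Fin m → Loc m
  tri : Fin m → Fin m → Fin m → Loc m

ValidLoc : ∀ {m} → Graph m → Loc m → Set
ValidLoc H (vtx x)     = ⊤
ValidLoc H (edg x y)   = Adj H x y
ValidLoc H (tri x y z) = IsTriangle H x y z

-- Extended strip decomposition (H, η) of G.  The partition condition (1) is encoded
-- by the function `loc`, which assigns each vertex of G to exactly one set η(o).
record ESD {n m : ℕ} (G : Graph n) (H : Graph m) : Set₁ where
  field
    loc       : Fin n → Loc m
    loc-valid : ∀ v → ValidLoc H (loc v)
    -- iface x y = η(xy, x)
    iface     : Fin m → Fin m → Fin n → Set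

  ηV : Fin m → Fin n → Set
  ηV x v = loc v ≡ vtx x
  ηE : Fin m → Fin m → Fin n → Set
  ηE x y v = loc v ≡ edg x y ⊎ loc v ≡ edg y x
  ηT : Fin m → Fin m → Fin m → Fin n → Set
  ηT x y z v = loc v ≡ tri x y z ⊎ loc v ≡ tri x z y ⊎ loc v ≡ tri y x z
             ⊎ loc v ≡ tri y z x ⊎ loc v ≡ tri z x y ⊎ loc v ≡ tri z y x

  EdgeOK : Fin n → Fin n → Set
  EdgeOK u v =
      (∃[ x ] ηV x u × ηV x v)
    ⊎ (∃[ x ] ∃[ y ] Adj H x y × ηE x y u × ηE x y v)
    ⊎ (∃[ x ] ∃[ y ] ∃[ z ] IsTriangle H x y z × ηT x y z u × ηT x y z v)
    ⊎ (∃[ x ] ∃[ y ] ∃[ z ] Adj H x y × Adj H x z × iface x y u × iface x z v)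
    ⊎ (∃[ x ] ∃[ y ] Adj H x y × iface x y u × ηV x v)
    ⊎ (∃[ x ] ∃[ y ] ∃[ z ] IsTriangle H x y z × ηT x y z u × iface x y v × iface y x v)

  field
    iface-sub : ∀ x y v → iface x y v → Adj H x y × ηE x y v
    complete  : ∀ x y z u w → Adj H x y → Adj H x z → y ≢ z →
                iface x y u → iface x z w → Adj G u w
    edges     : ∀ u v → Adj G u v → EdgeOK u v ⊎ EdgeOK v u
open ESD public

Peripheral : ∀ {n m} {G : Graph n} {H : Graph m} → ESD G H → Fin n → Set
Peripheral {H = H} D v =
  ∃[ x ] ∃[ y ] Adj H x y × (∀ z → Adj H x z → z ≡ y) × (∀ w → iface D x y w ⇔ (w ≡ v))

InducedPath : ∀ {n} → Graph n → (k : ℕ) → (Fin (suc k) → Fin n) → Set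
InducedPath G k p =
  Injective _≡_ _≡_ p ×
  (∀ i j → Adj G (p i) (p j) ⇔ (toℕ j ≡ suc (toℕ i) ⊎ toℕ i ≡ suc (toℕ j)))

{-# OPTIONS --safe #-}
-- An edge of G leaving one of the regions η(a), η(abc) or η(a) ∪ η(b) ∪ η(ab) ∪ ⋃_z η(abz)
-- enters an interface η(wc, w) at a corner w of that region.  Two vertices of Q at distance at
-- least two never lie in interfaces η(wc, w), η(wc′, w) at a common end w: for c ≠ c′ condition
-- (2) would give a chord, and for c = c′ this is the first claim.  That claim goes by strong
-- induction on the first index: if Q meets η(ab, a) at i < j, it leaves the region around ab
-- before i and after j through interfaces at b (one at a would be complete to η(ab, a)), giving
-- either a chord or two meetings of one η(bc, b) further apart.  An end of Q can lie in that
-- region only if b is a leaf with η(ba, b) = {end}, which excludes both ends at once as well as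
-- any η(bc, b) with c ≠ a.  For the second claim, the ends of Q lie in edge sets, so a vertex of
-- Q in η(a) or η(abc) would leave that set on both sides through interfaces at a common corner.
module Submission where

open import Defs
open import Data.Nat using (ℕ; suc)
open import Data.Fin using (Fin; zero; fromℕ)
open import Data.Product using (∃-syntax; _×_)
open import Relation.Binary.PropositionalEquality using (_≡_; _≢_)

open import Data.Nat.Base using (zero; _≤_; _<_; z≤n; s≤s; _≤‴_; ≤‴-reflexive; ≤‴-step)
open import Data.Nat.Properties
  using ( ≤-refl; ≤-reflexive; ≤-trans; <⇒≤; <-trans; ≤-<-trans; <-≤-trans; <-irrefl; <-asym
        ; n<1+n; ≤⇒≤‴; ≤‴⇒≤)
open import Data.Nat.Induction using (<-rec)
import Data.Fin as Fin
import Data.Fin.Properties as Fin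
open import Data.Fin using (suc; toℕ)
open import Data.Fin.Properties
  using (_≟_; toℕ-injective; toℕ-fromℕ; toℕ≤pred[n]; pigeonhole)
open import Data.List using (List; []; _∷_; length; lookup)
open import Data.List.Relation.Unary.Any using (here; there; index)
open import Data.List.Relation.Unary.Any.Properties using (lookup-index)
open import Data.List.Membership.Propositional using (_∈_)
open import Data.List.Membership.Propositional.Properties using (∈-lookup)
open import Data.List.Relation.Binary.Subset.Propositional using (_⊆_)
open import Data.List.Relation.Binary.Subset.Propositional.Properties using (⊆-refl)
open import Data.List.Relation.Binary.Permutation.Propositional
  using (_↭_; ↭-refl; ↭-prep; ↭-swap; ↭-trans; ↭-sym)
open import Data.List.Relation.Binary.Permutation.Propositional.Properties using (∈-resp-↭)
open import Data.Product using (_,_; proj₁; proj₂; ∃₂)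
import Data.Product as Product
open import Data.Sum using (_⊎_; inj₁; inj₂; [_,_]′)
import Data.Sum as Sum
open import Data.Empty using (⊥; ⊥-elim)
open import Function using (_∘_)
open import Function.Bundles using (Equivalence; _⇔_)
open import Relation.Nullary using (¬_; Dec; yes; no; contradiction)
open import Relation.Nullary.Decidable using (_×-dec_; _⊎-dec_; ¬?; decidable-stable; map′)
open import Relation.Unary using (Decidable)
open import Relation.Binary.Definitions using (tri<; tri≈; tri>)
open import Relation.Binary.PropositionalEquality
  using (refl; trans; cong; subst; subst₂; module ≡-Reasoning)
import Relation.Binary.PropositionalEquality as ≡

open Equivalence using (to; from)

crossing : ∀ {P : ℕ → Set} → Decidable P → ∀ {i j} → i ≤ j → P i → ¬ P j →
           ∃[ t ] i ≤ t × t < j × P t × ¬ P (suc t)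
crossing {P} P? i≤j = go (≤⇒≤‴ i≤j)
  where
  go : ∀ {i j} → i ≤‴ j → P i → ¬ P j → ∃[ t ] i ≤ t × t < j × P t × ¬ P (suc t)
  go (≤‴-reflexive refl) pi ¬pj = contradiction pi ¬pj
  go {i} (≤‴-step i<j) pi ¬pj with P? (suc i)
  ... | no ¬psi = i , ≤-refl , ≤‴⇒≤ i<j , pi , ¬psi
  ... | yes psi with go i<j psi ¬pj
  ...   | t , i<t , t<j , pt , ¬pst = t , <⇒≤ i<t , t<j , pt , ¬pst

⊆-pigeonhole : ∀ {a} {A : Set a} {xs ys : List A} → ys ⊆ xs → length xs < length ys →
               ∃₂ λ i j → i Fin.< j × lookup ys i ≡ lookup ys j
⊆-pigeonhole {xs = xs} {ys} ys⊆xs xs<ys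
  with i , j , i<j , same ← pigeonhole xs<ys (index ∘ ys⊆xs ∘ ∈-lookup) =
  i , j , i<j , (begin
    lookup ys i                          ≡⟨ lookup-index (ys⊆xs (∈-lookup i)) ⟩
    lookup xs (index (ys⊆xs (∈-lookup i))) ≡⟨ cong (lookup xs) same ⟩
    lookup xs (index (ys⊆xs (∈-lookup j))) ≡⟨ ≡.sym (lookup-index (ys⊆xs (∈-lookup j))) ⟩
    lookup ys j                          ∎)
  where open ≡-Reasoning

pairs-in-triple-meet : ∀ {a} {A : Set a} {x₁ y₁ x₂ y₂ p q r : A} → x₁ ≢ y₁ → x₂ ≢ y₂ →
                       x₁ ∷ y₁ ∷ x₂ ∷ y₂ ∷ [] ⊆ p ∷ q ∷ r ∷ [] →
                       x₁ ≡ x₂ ⊎ x₁ ≡ y₂ ⊎ y₁ ≡ x₂ ⊎ y₁ ≡ y₂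
pairs-in-triple-meet x₁≢y₁ x₂≢y₂ sub with ⊆-pigeonhole sub (n<1+n 3)
... | zero , suc zero , _ , e = ⊥-elim (x₁≢y₁ e)
... | zero , suc (suc zero) , _ , e = inj₁ e
... | zero , suc (suc (suc zero)) , _ , e = inj₂ (inj₁ e)
... | suc zero , suc (suc zero) , _ , e = inj₂ (inj₂ (inj₁ e))
... | suc zero , suc (suc (suc zero)) , _ , e = inj₂ (inj₂ (inj₂ e))
... | suc (suc zero) , suc (suc (suc zero)) , _ , e = ⊥-elim (x₂≢y₂ e)
... | zero , zero , () , _
... | suc _ , zero , () , _
... | suc zero , suc zero , s≤s () , _
... | suc (suc _) , suc zero , s≤s () , _
... | suc (suc zero) , suc (suc zero) , s≤s (s≤s ()) , _
... | suc (suc (suc _)) , suc (suc zero) , s≤s (s≤s ()) , _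
... | suc (suc (suc zero)) , suc (suc (suc zero)) , s≤s (s≤s (s≤s ())) , _

-- clamp i = min i k, so that Q can be read as the ℕ-indexed sequence Q ∘ clamp.
clamp : ∀ {k} → ℕ → Fin (suc k)
clamp zero = zero
clamp {zero} (suc i) = zero
clamp {suc k} (suc i) = suc (clamp i)

toℕ-clamp : ∀ {k i} → i ≤ k → toℕ (clamp {k} i) ≡ i
toℕ-clamp {i = zero} _ = refl
toℕ-clamp {suc k} {suc i} (s≤s i≤k) = cong suc (toℕ-clamp i≤k)

clamp-toℕ : ∀ {k} (i : Fin (suc k)) → clamp (toℕ i) ≡ i
clamp-toℕ zero = refl
clamp-toℕ {suc k} (suc i) = cong suc (clamp-toℕ i)

clamp-fromℕ : ∀ k → clamp k ≡ fromℕ k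
clamp-fromℕ k = toℕ-injective (trans (toℕ-clamp ≤-refl) (≡.sym (toℕ-fromℕ k)))

module _ {n k} {P : Fin n → Set} (Q : Fin (suc k) → Fin n) where

  at-clamp-toℕ : ∀ i → P (Q i) → P (Q (clamp (toℕ i)))
  at-clamp-toℕ i = subst (P ∘ Q) (≡.sym (clamp-toℕ i))

  clamp-at-most-once : (∀ {i j} → i < j → j ≤ k → P (Q (clamp i)) → P (Q (clamp j)) → ⊥) →
                       ∀ i j → P (Q i) → P (Q j) → i ≡ j
  clamp-at-most-once once i j pᵢ pⱼ with Fin.<-cmp i j
  ... | tri< i<j _ _ = ⊥-elim (once i<j (toℕ≤pred[n] j) (at-clamp-toℕ i pᵢ) (at-clamp-toℕ j pⱼ))
  ... | tri≈ _ i≡j _ = i≡j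
  ... | tri> _ _ j<i = ⊥-elim (once j<i (toℕ≤pred[n] i) (at-clamp-toℕ j pⱼ) (at-clamp-toℕ i pᵢ))

record InducedPathℕ {n} (G : Graph n) (k : ℕ) (q : ℕ → Fin n) : Set where
  field
    injective : ∀ {i j} → i ≤ k → j ≤ k → q i ≡ q j → i ≡ j
    adjacent  : ∀ {i} → suc i ≤ k → Adj G (q i) (q (suc i))
    chordless : ∀ {i j} → j ≤ k → suc i < j → ¬ Adj G (q i) (q j)

InducedPath⇒InducedPathℕ : ∀ {n} {G : Graph n} {k Q} → InducedPath G k Q →
                           InducedPathℕ G k (Q ∘ clamp)
InducedPath⇒InducedPathℕ {G = G} {k} {Q} (Q-injective , Q-adjacent) = record
  { injective = λ i≤k j≤k e →
      trans (≡.sym (toℕ-clamp i≤k)) (trans (cong toℕ (Q-injective e)) (toℕ-clamp j≤k))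
  ; adjacent  = λ {i} i<k → from (Q-adjacent (clamp i) (clamp (suc i)))
      (inj₁ (trans (toℕ-clamp i<k) (cong suc (≡.sym (toℕ-clamp (<⇒≤ i<k))))))
  ; chordless = chordless
  }
  where
  chordless : ∀ {i j} → j ≤ k → suc i < j → ¬ Adj G (Q (clamp i)) (Q (clamp j))
  chordless {i} {j} j≤k i+1<j ij =
    [ (λ j≡1+i → <-irrefl (≡.sym j≡1+i) i+1<j)
    , (λ i≡1+j → <-asym i<j (≤-reflexive (≡.sym i≡1+j)))
    ]′ (subst₂ (λ i′ j′ → j′ ≡ suc i′ ⊎ i′ ≡ suc j′)
               (toℕ-clamp (<⇒≤ (<-≤-trans i<j j≤k))) (toℕ-clamp j≤k)
               (to (Q-adjacent (clamp i) (clamp j)) ij))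
    where
    i<j : i < j
    i<j = <-trans (n<1+n i) i+1<j

module _ {n} {G : Graph n} {k} {q : ℕ → Fin n} (path : InducedPathℕ G k q) where
  open InducedPathℕ path

  distinct : ∀ {i j} → i < j → j ≤ k → q i ≢ q j
  distinct i<j j≤k e = <-irrefl (injective (<⇒≤ (<-≤-trans i<j j≤k)) j≤k e) i<j

  module _ {R B : Fin n → Set} (R? : Decidable R)
           (exit : ∀ {u v} → R u → ¬ R v → Adj G u v → B v) where

    exit-before : ∀ {i} → ¬ R (q 0) → i ≤ k → R (q i) → ∃[ s ] s < i × B (q s)
    exit-before ¬r₀ i≤k rᵢ
      with s , _ , s<i , ¬rₛ , ¬¬rₛ₊₁ ← crossing (¬? ∘ R? ∘ q) z≤n ¬r₀ (λ ¬rᵢ → ¬rᵢ rᵢ) =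
      s , s<i , exit (decidable-stable (R? (q (suc s))) ¬¬rₛ₊₁) ¬rₛ
                     (sym G (adjacent (≤-trans s<i i≤k)))

    exit-after : ∀ {j} → ¬ R (q k) → j ≤ k → R (q j) → ∃[ t ] j < t × t ≤ k × B (q t)
    exit-after ¬rₖ j≤k rⱼ with t , j≤t , t<k , rₜ , ¬rₜ₊₁ ← crossing (R? ∘ q) j≤k rⱼ ¬rₖ =
      suc t , s≤s j≤t , t<k , exit rₜ ¬rₜ₊₁ (adjacent t<k)

    exits-around : ∀ {i} → ¬ R (q 0) → ¬ R (q k) → i ≤ k → R (q i) →
                   ∃₂ λ s t → suc s < t × t ≤ k × B (q s) × B (q t)
    exits-around ¬r₀ ¬rₖ i≤k rᵢ
      with s , s<i , bₛ ← exit-before ¬r₀ i≤k rᵢ | t , i<t , t≤k , bₜ ← exit-after ¬rₖ i≤k rᵢ =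
      s , t , ≤-<-trans s<i i<t , t≤k , bₛ , bₜ

module _ {m : ℕ} where

  -- ηE D x y v and ηT D x y z v unfold to ηEL x y (loc D v) and ηTL x y z (loc D v); stated for
  -- a variable location, facts about them can be proved by matching on refl.
  ηEL : Fin m → Fin m → Loc m → Set
  ηEL x y l = l ≡ edg x y ⊎ l ≡ edg y x

  ηTL : Fin m → Fin m → Fin m → Loc m → Set
  ηTL x y z l = l ≡ tri x y z ⊎ l ≡ tri x z y ⊎ l ≡ tri y x z
              ⊎ l ≡ tri y z x ⊎ l ≡ tri z x y ⊎ l ≡ tri z y x

  data TriangleOn (xs : List (Fin m)) : Loc m → Set where
    triangleOn : ∀ {p q r} → p ∷ q ∷ r ∷ [] ↭ xs → TriangleOn xs (tri p q r)

  ηTL⇒TriangleOn : ∀ {x y z l} → ηTL x y z l → TriangleOn (x ∷ y ∷ z ∷ []) l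
  ηTL⇒TriangleOn (inj₁ refl) = triangleOn ↭-refl
  ηTL⇒TriangleOn {x} {y} {z} (inj₂ (inj₁ refl)) = triangleOn (↭-prep x (↭-swap z y ↭-refl))
  ηTL⇒TriangleOn {x} {y} {z} (inj₂ (inj₂ (inj₁ refl))) = triangleOn (↭-swap y x ↭-refl)
  ηTL⇒TriangleOn {x} {y} {z} (inj₂ (inj₂ (inj₂ (inj₁ refl)))) =
    triangleOn (↭-trans (↭-prep y (↭-swap z x ↭-refl)) (↭-swap y x ↭-refl))
  ηTL⇒TriangleOn {x} {y} {z} (inj₂ (inj₂ (inj₂ (inj₂ (inj₁ refl))))) =
    triangleOn (↭-trans (↭-swap z x ↭-refl) (↭-prep x (↭-swap z y ↭-refl)))
  ηTL⇒TriangleOn {x} {y} {z} (inj₂ (inj₂ (inj₂ (inj₂ (inj₂ refl))))) =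
    triangleOn (↭-trans (↭-swap z y ↭-refl)
               (↭-trans (↭-prep y (↭-swap z x ↭-refl)) (↭-swap y x ↭-refl)))

  vtx-injective : ∀ {a b : Fin m} → vtx a ≡ vtx b → a ≡ b
  vtx-injective refl = refl

  vtx? : ∀ a (l : Loc m) → Dec (l ≡ vtx a)
  vtx? a (vtx x) = map′ (cong vtx) vtx-injective (x ≟ a)
  vtx? a (edg _ _) = no λ ()
  vtx? a (tri _ _ _) = no λ ()

  edge-not-vertex : ∀ {x y a l} → ηEL x y l → l ≢ vtx a
  edge-not-vertex (inj₁ refl) ()
  edge-not-vertex (inj₂ refl) ()

  triangle-not-vertex : ∀ {x y z a l} → ηTL x y z l → l ≢ vtx a
  triangle-not-vertex t refl with () ← ηTL⇒TriangleOn t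

  EdgeRegion : Fin m → Fin m → Loc m → Set
  EdgeRegion a b (vtx x) = x ≡ a ⊎ x ≡ b
  EdgeRegion a b (edg x y) = (x ≡ a × y ≡ b) ⊎ (x ≡ b × y ≡ a)
  EdgeRegion a b (tri x y z) = a ∈ x ∷ y ∷ z ∷ [] × b ∈ x ∷ y ∷ z ∷ []

  edgeRegion? : ∀ a b l → Dec (EdgeRegion a b l)
  edgeRegion? a b (vtx x) = x ≟ a ⊎-dec x ≟ b
  edgeRegion? a b (edg x y) = (x ≟ a ×-dec y ≟ b) ⊎-dec (x ≟ b ×-dec y ≟ a)
  edgeRegion? a b (tri x y z) = a ∈? (x ∷ y ∷ z ∷ []) ×-dec b ∈? (x ∷ y ∷ z ∷ [])
    where open import Data.List.Membership.DecPropositional _≟_ using (_∈?_)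

  ηEL⇒EdgeRegion : ∀ {a b l} → ηEL a b l → EdgeRegion a b l
  ηEL⇒EdgeRegion (inj₁ refl) = inj₁ (refl , refl)
  ηEL⇒EdgeRegion (inj₂ refl) = inj₂ (refl , refl)

  edge-in-EdgeRegion : ∀ {a b x y l} → EdgeRegion a b l → ηEL x y l →
                       (x ≡ a × y ≡ b) ⊎ (x ≡ b × y ≡ a)
  edge-in-EdgeRegion r (inj₁ refl) = r
  edge-in-EdgeRegion r (inj₂ refl) = Sum.swap (Sum.map Product.swap Product.swap r)

  end-in-EdgeRegion : ∀ {a b x y l} → EdgeRegion a b l → ηEL x y l → x ≡ a ⊎ x ≡ b
  end-in-EdgeRegion r e = Sum.map proj₁ proj₁ (edge-in-EdgeRegion r e)

  EdgeRegion-corners : ∀ {a b x y z l} → EdgeRegion a b l → ηTL x y z l →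
                       a ∈ x ∷ y ∷ z ∷ [] × b ∈ x ∷ y ∷ z ∷ []
  EdgeRegion-corners r t with triangleOn σ ← ηTL⇒TriangleOn t =
    Product.map (∈-resp-↭ σ) (∈-resp-↭ σ) r

  corners⇒EdgeRegion : ∀ {a b x y z l} → ηTL x y z l →
                       a ∈ x ∷ y ∷ z ∷ [] → b ∈ x ∷ y ∷ z ∷ [] → EdgeRegion a b l
  corners⇒EdgeRegion t a∈ b∈ with triangleOn σ ← ηTL⇒TriangleOn t =
    ∈-resp-↭ (↭-sym σ) a∈ , ∈-resp-↭ (↭-sym σ) b∈

  TriangleRegion : List (Fin m) → Loc m → Set
  TriangleRegion xs (tri p q r) = p ∷ q ∷ r ∷ [] ⊆ xs
  TriangleRegion xs _ = ⊥

  triangleRegion? : ∀ xs l → Dec (TriangleRegion xs l)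
  triangleRegion? xs (vtx _) = no λ ()
  triangleRegion? xs (edg _ _) = no λ ()
  triangleRegion? xs (tri p q r) = (p ∷ q ∷ r ∷ []) ⊆? xs
    where open import Data.List.Relation.Binary.Subset.DecPropositional _≟_ using (_⊆?_)

  edge-not-in-TriangleRegion : ∀ {x y xs l} → ηEL x y l → ¬ TriangleRegion xs l
  edge-not-in-TriangleRegion (inj₁ refl) ()
  edge-not-in-TriangleRegion (inj₂ refl) ()

  TriangleRegion-corners : ∀ {xs x y z l} → TriangleRegion xs l → ηTL x y z l → x ∈ xs × y ∈ xs
  TriangleRegion-corners r t with triangleOn σ ← ηTL⇒TriangleOn t =
    r (∈-resp-↭ (↭-sym σ) (here refl)) , r (∈-resp-↭ (↭-sym σ) (there (here refl)))

  TriangleRegion-transfer : ∀ {xs x y z l l′} → TriangleRegion xs l → ηTL x y z l → ηTL x y z l′ →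
                            TriangleRegion xs l′
  TriangleRegion-transfer r t t′
    with triangleOn σ ← ηTL⇒TriangleOn t | triangleOn σ′ ← ηTL⇒TriangleOn t′ =
    r ∘ ∈-resp-↭ (↭-sym σ) ∘ ∈-resp-↭ σ′

module _ {n m} {G : Graph n} {H : Graph m} (D : ESD G H) where

  iface-adj : ∀ {a b v} → iface D a b v → Adj H a b
  iface-adj = proj₁ ∘ iface-sub D _ _ _

  iface⇒ηE : ∀ {a b v} → iface D a b v → ηE D a b v
  iface⇒ηE = proj₂ ∘ iface-sub D _ _ _

  iface-ends-distinct : ∀ {a b v} → iface D a b v → a ≢ b
  iface-ends-distinct i refl = irrefl H (iface-adj i)

  data Link (u v : Fin n) : Set where
    same-vertex           : ∀ {x} → ηV D x u → ηV D x v → Link u v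
    same-edge             : ∀ {x y} → ηE D x y u → ηE D x y v → Link u v
    same-triangle         : ∀ {x y z} → ηT D x y z u → ηT D x y z v → Link u v
    interfaces            : ∀ {x y z} → iface D x y u → iface D x z v → Link u v
    interface-to-vertex   : ∀ {x y} → iface D x y u → ηV D x v → Link u v
    vertex-to-interface   : ∀ {x y} → ηV D x u → iface D x y v → Link u v
    interface-to-triangle : ∀ {x y z} → iface D x y u → iface D y x u → ηT D x y z v → Link u v
    triangle-to-interface : ∀ {x y z} → ηT D x y z u → iface D x y v → iface D y x v → Link u v

  Link-sym : ∀ {u v} → Link u v → Link v u
  Link-sym (same-vertex eu ev) = same-vertex ev eu
  Link-sym (same-edge eu ev) = same-edge ev eu
  Link-sym (same-triangle tu tv) = same-triangle tv tu
  Link-sym (interfaces iu iv) = interfaces iv iu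
  Link-sym (interface-to-vertex iu ev) = vertex-to-interface ev iu
  Link-sym (vertex-to-interface eu iv) = interface-to-vertex iv eu
  Link-sym (interface-to-triangle iu iu′ tv) = triangle-to-interface tv iu iu′
  Link-sym (triangle-to-interface tu iv iv′) = interface-to-triangle iv iv′ tu

  EdgeOK⇒Link : ∀ {u v} → EdgeOK D u v → Link u v
  EdgeOK⇒Link (inj₁ (_ , eu , ev)) = same-vertex eu ev
  EdgeOK⇒Link (inj₂ (inj₁ (_ , _ , _ , eu , ev))) = same-edge eu ev
  EdgeOK⇒Link (inj₂ (inj₂ (inj₁ (_ , _ , _ , _ , tu , tv)))) = same-triangle tu tv
  EdgeOK⇒Link (inj₂ (inj₂ (inj₂ (inj₁ (_ , _ , _ , _ , _ , iu , iv))))) = interfaces iu iv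
  EdgeOK⇒Link (inj₂ (inj₂ (inj₂ (inj₂ (inj₁ (_ , _ , _ , iu , ev)))))) = interface-to-vertex iu ev
  EdgeOK⇒Link (inj₂ (inj₂ (inj₂ (inj₂ (inj₂ (_ , _ , _ , _ , tu , iv , iv′)))))) =
    triangle-to-interface tu iv iv′

  link : ∀ {u v} → Adj G u v → Link u v
  link {u} {v} uv = [ EdgeOK⇒Link , Link-sym ∘ EdgeOK⇒Link ]′ (edges D u v uv)

  exit-vertex-set : ∀ {a u v} → ηV D a u → ¬ ηV D a v → Adj G u v → ∃[ c ] iface D a c v
  exit-vertex-set {a} eu ¬ev uv with link uv
  ... | same-vertex eu′ ev = contradiction (trans ev (trans (≡.sym eu′) eu)) ¬ev
  ... | same-edge eu′ _ = contradiction eu (edge-not-vertex eu′)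
  ... | same-triangle tu _ = contradiction eu (triangle-not-vertex tu)
  ... | interfaces iu _ = contradiction eu (edge-not-vertex (iface⇒ηE iu))
  ... | interface-to-vertex iu _ = contradiction eu (edge-not-vertex (iface⇒ηE iu))
  ... | vertex-to-interface eu′ iv with refl ← vtx-injective (trans (≡.sym eu′) eu) = _ , iv
  ... | interface-to-triangle iu _ _ = contradiction eu (edge-not-vertex (iface⇒ηE iu))
  ... | triangle-to-interface tu _ _ = contradiction eu (triangle-not-vertex tu)

  data SideExit (a b : Fin m) (v : Fin n) : Set where
    via-a : ∀ {c} → c ≢ b → iface D a c v → SideExit a b v
    via-b : ∀ {c} → c ≢ a → iface D b c v → SideExit a b v

  side-exit : ∀ {a b w c v} → w ≡ a ⊎ w ≡ b → iface D w c v → ¬ EdgeRegion a b (loc D v) →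
              SideExit a b v
  side-exit {a} {b} {c = c} (inj₁ refl) iv ¬r with c ≟ b
  ... | yes refl = contradiction (ηEL⇒EdgeRegion (iface⇒ηE iv)) ¬r
  ... | no c≢b = via-a c≢b iv
  side-exit {a} {b} {c = c} (inj₂ refl) iv ¬r with c ≟ a
  ... | yes refl = contradiction (ηEL⇒EdgeRegion (Sum.swap (iface⇒ηE iv))) ¬r
  ... | no c≢a = via-b c≢a iv

  exit-EdgeRegion : ∀ {a b u v} → a ≢ b → EdgeRegion a b (loc D u) → ¬ EdgeRegion a b (loc D v) →
                    Adj G u v → SideExit a b v
  exit-EdgeRegion {a} {b} a≢b r ¬r uv with link uv
  ... | same-vertex eu ev = contradiction (subst (EdgeRegion a b) (trans eu (≡.sym ev)) r) ¬r
  ... | same-edge eu ev with edge-in-EdgeRegion r eu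
  ...   | inj₁ (refl , refl) = contradiction (ηEL⇒EdgeRegion ev) ¬r
  ...   | inj₂ (refl , refl) = contradiction (ηEL⇒EdgeRegion (Sum.swap ev)) ¬r
  exit-EdgeRegion a≢b r ¬r uv | same-triangle tu tv =
    contradiction (Product.uncurry (corners⇒EdgeRegion tv) (EdgeRegion-corners r tu)) ¬r
  exit-EdgeRegion a≢b r ¬r uv | interfaces iu iv = side-exit (end-in-EdgeRegion r (iface⇒ηE iu)) iv ¬r
  exit-EdgeRegion {a} {b} a≢b r ¬r uv | interface-to-vertex iu ev =
    contradiction (subst (EdgeRegion a b) (≡.sym ev) (end-in-EdgeRegion r (iface⇒ηE iu))) ¬r
  exit-EdgeRegion {a} {b} a≢b r ¬r uv | vertex-to-interface eu iv =
    side-exit (subst (EdgeRegion a b) eu r) iv ¬r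
  exit-EdgeRegion a≢b r ¬r uv | interface-to-triangle iu _ tv with edge-in-EdgeRegion r (iface⇒ηE iu)
  ... | inj₁ (refl , refl) = contradiction (corners⇒EdgeRegion tv (here refl) (there (here refl))) ¬r
  ... | inj₂ (refl , refl) = contradiction (corners⇒EdgeRegion tv (there (here refl)) (here refl)) ¬r
  exit-EdgeRegion a≢b r ¬r uv | triangle-to-interface tu iv iv′ with EdgeRegion-corners r tu
  ... | here refl , here refl = contradiction refl a≢b
  ... | here refl , there _ = side-exit (inj₁ refl) iv ¬r
  ... | there _ , here refl = side-exit (inj₂ refl) iv ¬r
  ... | there (here refl) , _ = side-exit (inj₁ refl) iv′ ¬r
  ... | there (there _) , there (here refl) = side-exit (inj₂ refl) iv′ ¬r
  ... | there (there (here refl)) , there (there (here refl)) = contradiction refl a≢b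

  TriangleExit : List (Fin m) → Fin n → Set
  TriangleExit xs v = ∃₂ λ x y → x ∈ xs × y ∈ xs × iface D x y v × iface D y x v

  exit-TriangleRegion : ∀ {xs u v} → TriangleRegion xs (loc D u) → ¬ TriangleRegion xs (loc D v) →
                        Adj G u v → TriangleExit xs v
  exit-TriangleRegion {xs} r ¬r uv with link uv
  ... | same-vertex eu ev = contradiction (subst (TriangleRegion xs) (trans eu (≡.sym ev)) r) ¬r
  ... | same-edge eu _ = contradiction r (edge-not-in-TriangleRegion eu)
  ... | same-triangle tu tv = contradiction (TriangleRegion-transfer r tu tv) ¬r
  ... | interfaces iu _ = contradiction r (edge-not-in-TriangleRegion (iface⇒ηE iu))
  ... | interface-to-vertex iu _ = contradiction r (edge-not-in-TriangleRegion (iface⇒ηE iu))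
  ... | vertex-to-interface eu _ = ⊥-elim (subst (TriangleRegion xs) eu r)
  ... | interface-to-triangle iu _ _ = contradiction r (edge-not-in-TriangleRegion (iface⇒ηE iu))
  ... | triangle-to-interface tu iv iv′ =
    let x∈ , y∈ = TriangleRegion-corners r tu in _ , _ , x∈ , y∈ , iv , iv′

  PeripheralVia : Fin m → Fin m → Fin n → Set
  PeripheralVia p p′ z = (∀ c → Adj H p c → c ≡ p′) × (∀ w → iface D p p′ w ⇔ w ≡ z)

  peripheral-in-edge-set : ∀ {z} → Peripheral D z → ∃₂ λ p p′ → ηE D p p′ z
  peripheral-in-edge-set {z} (p , p′ , _ , _ , only) = p , p′ , iface⇒ηE (from (only z) refl)

  peripheral-in-EdgeRegion : ∀ {a b z u w} → Peripheral D z → EdgeRegion a b (loc D z) →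
                             iface D a b u → iface D a b w → u ≢ w → PeripheralVia b a z
  peripheral-in-EdgeRegion {z = z} {u} {w} (p , p′ , _ , leaf , only) r iu iw u≢w
    with edge-in-EdgeRegion r (iface⇒ηE (from (only z) refl))
  ... | inj₁ (refl , refl) = contradiction (trans (to (only u) iu) (≡.sym (to (only w) iw))) u≢w
  ... | inj₂ (refl , refl) = leaf , only

module OnPath {n m} {G : Graph n} {H : Graph m} (D : ESD G H) {x y : Fin n} (x≢y : x ≢ y)
              (px : Peripheral D x) (py : Peripheral D y)
              {k} {q : ℕ → Fin n} (path : InducedPathℕ G k q) (q₀≡x : q 0 ≡ x) (qₖ≡y : q k ≡ y) where
  open InducedPathℕ path

  no-far-pair-in-distinct-interfaces : ∀ {w c c′ s t} → c ≢ c′ → suc s < t → t ≤ k →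
                                       iface D w c (q s) → iface D w c′ (q t) → ⊥
  no-far-pair-in-distinct-interfaces c≢c′ s+1<t t≤k iₛ iₜ =
    chordless t≤k s+1<t (complete D _ _ _ _ _ (iface-adj D iₛ) (iface-adj D iₜ) c≢c′ iₛ iₜ)

  LeavesBefore LeavesAfter : Fin m → Fin m → ℕ → Set
  LeavesBefore a b i = PeripheralVia D b a x ⊎ ∃₂ λ c s → s < i × c ≢ a × iface D b c (q s)
  LeavesAfter a b j = PeripheralVia D b a y ⊎ ∃₂ λ c t → j < t × t ≤ k × c ≢ a × iface D b c (q t)

  leaves-before : ∀ {a b i j} → i < j → j ≤ k → iface D a b (q i) → iface D a b (q j) →
                  LeavesBefore a b i
  leaves-before {a} {b} i<j j≤k iᵢ iⱼ with edgeRegion? a b (loc D (q 0))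
  ... | yes r₀ = inj₁ (peripheral-in-EdgeRegion D px (subst (EdgeRegion a b ∘ loc D) q₀≡x r₀) iᵢ iⱼ
                         (distinct path i<j j≤k))
  ... | no ¬r₀
    with exit-before path (edgeRegion? a b ∘ loc D) (exit-EdgeRegion D (iface-ends-distinct D iᵢ))
           ¬r₀ (<⇒≤ (<-≤-trans i<j j≤k)) (ηEL⇒EdgeRegion (iface⇒ηE D iᵢ))
  ...   | s , s<i , via-a c≢b iₛ =
          ⊥-elim (no-far-pair-in-distinct-interfaces c≢b (≤-<-trans s<i i<j) j≤k iₛ iⱼ)
  ...   | s , s<i , via-b c≢a iₛ = inj₂ (_ , s , s<i , c≢a , iₛ)

  leaves-after : ∀ {a b i j} → i < j → j ≤ k → iface D a b (q i) → iface D a b (q j) →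
                 LeavesAfter a b j
  leaves-after {a} {b} i<j j≤k iᵢ iⱼ with edgeRegion? a b (loc D (q k))
  ... | yes rₖ = inj₁ (peripheral-in-EdgeRegion D py (subst (EdgeRegion a b ∘ loc D) qₖ≡y rₖ) iᵢ iⱼ
                         (distinct path i<j j≤k))
  ... | no ¬rₖ
    with exit-after path (edgeRegion? a b ∘ loc D) (exit-EdgeRegion D (iface-ends-distinct D iᵢ))
           ¬rₖ j≤k (ηEL⇒EdgeRegion (iface⇒ηE D iⱼ))
  ...   | t , j<t , t≤k , via-a c≢b iₜ =
          ⊥-elim (no-far-pair-in-distinct-interfaces (c≢b ∘ ≡.sym) (≤-<-trans i<j j<t) t≤k iᵢ iₜ)
  ...   | t , j<t , t≤k , via-b c≢a iₜ = inj₂ (_ , t , j<t , t≤k , c≢a , iₜ)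

  interface-meets-path-once : ∀ {a b i j} → i < j → j ≤ k → iface D a b (q i) → iface D a b (q j) → ⊥
  interface-meets-path-once {i = i} = <-rec Claim step i
    where
    Claim : ℕ → Set
    Claim i = ∀ {a b j} → i < j → j ≤ k → iface D a b (q i) → iface D a b (q j) → ⊥
    step : ∀ i → (∀ {s} → s < i → Claim s) → Claim i
    step i rec {a} {b} {j} i<j j≤k iᵢ iⱼ =
      meet (leaves-before i<j j≤k iᵢ iⱼ) (leaves-after i<j j≤k iᵢ iⱼ)
      where
      meet : LeavesBefore a b i → LeavesAfter a b j → ⊥
      meet (inj₁ (_ , x-only)) (inj₁ (_ , y-only)) = x≢y (≡.sym (to (x-only y) (from (y-only y) refl)))
      meet (inj₁ (b-leaf , _)) (inj₂ (c , _ , _ , _ , c≢a , iₜ)) = c≢a (b-leaf c (iface-adj D iₜ))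
      meet (inj₂ (c , _ , _ , c≢a , iₛ)) (inj₁ (b-leaf , _)) = c≢a (b-leaf c (iface-adj D iₛ))
      meet (inj₂ (c , s , s<i , _ , iₛ)) (inj₂ (c′ , t , j<t , t≤k , _ , iₜ)) with c ≟ c′
      ... | yes refl = rec s<i (<-trans s<i i<t) t≤k iₛ iₜ
        where i<t = <-trans i<j j<t
      ... | no c≢c′ = no-far-pair-in-distinct-interfaces c≢c′ (≤-<-trans s<i i<t) t≤k iₛ iₜ
        where i<t = <-trans i<j j<t

  no-far-pair-at-common-end : ∀ {w c c′ s t} → suc s < t → t ≤ k →
                              iface D w c (q s) → iface D w c′ (q t) → ⊥
  no-far-pair-at-common-end {c = c} {c′} s+1<t t≤k iₛ iₜ with c ≟ c′
  ... | yes refl = interface-meets-path-once (<-trans (n<1+n _) s+1<t) t≤k iₛ iₜ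
  ... | no c≢c′ = no-far-pair-in-distinct-interfaces c≢c′ s+1<t t≤k iₛ iₜ

  ends-outside : ∀ {R : Loc m → Set} → (∀ {p p′ l} → ηEL p p′ l → ¬ R l) →
                 ¬ R (loc D (q 0)) × ¬ R (loc D (q k))
  ends-outside outside
    with _ , _ , eₓ ← peripheral-in-edge-set D px | _ , _ , eᵧ ← peripheral-in-edge-set D py =
    outside (subst (ηE D _ _) (≡.sym q₀≡x) eₓ) , outside (subst (ηE D _ _) (≡.sym qₖ≡y) eᵧ)

  not-in-vertex-set : ∀ {a i} → i ≤ k → ¬ ηV D a (q i)
  not-in-vertex-set {a} i≤k eᵢ
    with s , t , s+1<t , t≤k , (_ , iₛ) , (_ , iₜ) ←
         Product.uncurry (exits-around path (vtx? a ∘ loc D) (exit-vertex-set D))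
           (ends-outside edge-not-vertex) i≤k eᵢ =
    no-far-pair-at-common-end s+1<t t≤k iₛ iₜ

  not-in-triangle-region : ∀ {a b c i} → i ≤ k → ¬ TriangleRegion (a ∷ b ∷ c ∷ []) (loc D (q i))
  not-in-triangle-region {a} {b} {c} i≤k rᵢ
    with s , t , s+1<t , t≤k , (x₁ , y₁ , x₁∈ , y₁∈ , iₛ , iₛ′) , (x₂ , y₂ , x₂∈ , y₂∈ , iₜ , iₜ′) ←
         Product.uncurry
           (exits-around path (triangleRegion? (a ∷ b ∷ c ∷ []) ∘ loc D) (exit-TriangleRegion D))
           (ends-outside edge-not-in-TriangleRegion) i≤k rᵢ
    with pairs-in-triple-meet (iface-ends-distinct D iₛ) (iface-ends-distinct D iₜ)
           (λ { (here refl) → x₁∈ ; (there (here refl)) → y₁∈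
              ; (there (there (here refl))) → x₂∈ ; (there (there (there (here refl)))) → y₂∈ })
  ... | inj₁ refl = no-far-pair-at-common-end s+1<t t≤k iₛ iₜ
  ... | inj₂ (inj₁ refl) = no-far-pair-at-common-end s+1<t t≤k iₛ iₜ′
  ... | inj₂ (inj₂ (inj₁ refl)) = no-far-pair-at-common-end s+1<t t≤k iₛ′ iₜ
  ... | inj₂ (inj₂ (inj₂ refl)) = no-far-pair-at-common-end s+1<t t≤k iₛ′ iₜ′

  in-edge-set : ∀ {i} → i ≤ k → ∃₂ λ a b → Adj H a b × ηE D a b (q i)
  in-edge-set {i} i≤k = by-location (loc D (q i)) refl
    where
    by-location : ∀ l → loc D (q i) ≡ l → ∃₂ λ a b → Adj H a b × ηE D a b (q i)
    by-location (vtx a) e = ⊥-elim (not-in-vertex-set i≤k e)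
    by-location (edg a b) e = a , b , subst (ValidLoc H) e (loc-valid D (q i)) , inj₁ e
    by-location (tri a b c) e =
      ⊥-elim (not-in-triangle-region i≤k (subst (TriangleRegion _) (≡.sym e) ⊆-refl))

lemma10 : ∀ {n m} (G : Graph n) (H : Graph m) (D : ESD G H) (x y : Fin n) →
          x ≢ y → Peripheral D x → Peripheral D y →
          (k : ℕ) (Q : Fin (suc k) → Fin n) → InducedPath G k Q →
          Q zero ≡ x → Q (fromℕ k) ≡ y →
          (∀ a b → Adj H a b → ∀ i j → iface D a b (Q i) → iface D a b (Q j) → i ≡ j)
          × (∀ i → ∃[ a ] ∃[ b ] Adj H a b × ηE D a b (Q i))
lemma10 G H D x y x≢y px py k Q Q-path Q₀≡x Qₖ≡y = meets-once , in-edge-set′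
  where
  open OnPath D x≢y px py (InducedPath⇒InducedPathℕ Q-path) Q₀≡x (trans (cong Q (clamp-fromℕ k)) Qₖ≡y)
  meets-once : ∀ a b → Adj H a b → ∀ i j → iface D a b (Q i) → iface D a b (Q j) → i ≡ j
  meets-once a b _ = clamp-at-most-once {P = iface D a b} Q interface-meets-path-once
  in-edge-set′ : ∀ i → ∃[ a ] ∃[ b ] Adj H a b × ηE D a b (Q i)
  in-edge-set′ i = subst (λ v → ∃[ a ] ∃[ b ] Adj H a b × ηE D a b v) (cong Q (clamp-toℕ i))
                         (in-edge-set (toℕ≤pred[n] i))
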